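{- For every integer $r\geq 2$, the graph $K^*_{2r+1,2r+1}$ is doubly Eulerian.
   Context: $K^*_{2r+1,2r+1}$ denotes the complete bipartite graph $K_{2r+1,2r+1}$ with the edges of a perfect matching removed. An Eulerian circuit is a closed trail traversing every edge exactly once. Let $G$ be Eulerian with $m$ edges and $u$ a vertex. Two Eulerian circuits $u,v_1,\ldots,v_{m-1},u$ and $u,w_1,\ldots,w_{m-1},u$ are avoiding if for every $1\le i\le m-1$, $v_i\neq w_i$ and $v_i$ is not adjacent to $w_i$. $G$ is doubly Eulerian if it is Eulerian and for every vertex $u$ there is a pair of avoiding Eulerian circuits starting and ending at $u$. -}

module Defs where

open import Level using (0ℓ)
open import Data.Nat using (ℕ; zero; suc; _+_; _*_; _≤_; _<_)
open import Data.Fin using (Fin; toℕ; inject₁; fromℕ)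
open import Data.Sum using (_⊎_; inj₁; inj₂)
open import Data.Product using (Σ; _×_; _,_; ∃-syntax)
open import Data.Empty using (⊥)
open import Relation.Nullary using (¬_)
open import Relation.Binary.PropositionalEquality using (_≡_; _≢_)

record Graph : Set₁ where
  field
    V     : Set
    Adj   : V → V → Set
    sym   : ∀ {x y} → Adj x y → Adj y x
    irrefl : ∀ {x} → ¬ Adj x x
open Graph public

SameEdge : {V : Set} → V → V → V → V → Set
SameEdge a b c d = (a ≡ c × b ≡ d) ⊎ (a ≡ d × b ≡ c)

-- A closed walk of length ℓ starting and ending at u:
-- vertices  walk 0 = u, walk 1, ..., walk ℓ = u,
-- step j : Fin ℓ goes from walk (inject₁ j) to walk (suc j).
record EulerianCircuit (G : Graph) (u : V G) (ℓ : ℕ) : Set where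
  field
    walk    : Fin (suc ℓ) → V G
    start   : walk Data.Fin.zero ≡ u
    end     : walk (fromℕ ℓ) ≡ u
    isEdge  : (j : Fin ℓ) → Adj G (walk (inject₁ j)) (walk (Data.Fin.suc j))
    noRepeat : (i j : Fin ℓ) →
               SameEdge (walk (inject₁ i)) (walk (Data.Fin.suc i))
                        (walk (inject₁ j)) (walk (Data.Fin.suc j)) → i ≡ j
    covers  : (x y : V G) → Adj G x y →
              ∃[ j ] SameEdge (walk (inject₁ j)) (walk (Data.Fin.suc j)) x y
open EulerianCircuit public

Eulerian : Graph → Set
Eulerian G = Σ (V G) λ u → Σ ℕ λ ℓ → EulerianCircuit G u ℓ

Avoiding : {G : Graph} {u : V G} {ℓ : ℕ} → EulerianCircuit G u ℓ → EulerianCircuit G u ℓ → Set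
Avoiding {G} {u} {ℓ} c d =
  (i : Fin (suc ℓ)) → 1 ≤ toℕ i → toℕ i < ℓ →
    (walk c i ≢ walk d i) × ¬ Adj G (walk c i) (walk d i)

DoublyEulerian : Graph → Set
DoublyEulerian G =
  Eulerian G ×
  ((u : V G) → Σ ℕ λ ℓ → Σ (EulerianCircuit G u ℓ) λ c → Σ (EulerianCircuit G u ℓ) λ d → Avoiding c d)

-- K*_{n,n}: K_{n,n} minus a perfect matching.  Vertices: two copies of Fin n;
-- inj₁ i ~ inj₂ j iff i ≢ j.
KAdj : (n : ℕ) → Fin n ⊎ Fin n → Fin n ⊎ Fin n → Set
KAdj n (inj₁ i) (inj₁ j) = ⊥
KAdj n (inj₁ i) (inj₂ j) = i ≢ j
KAdj n (inj₂ i) (inj₁ j) = i ≢ j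
KAdj n (inj₂ i) (inj₂ j) = ⊥

private
  ≢-sym : {A : Set} {a b : A} → a ≢ b → b ≢ a
  ≢-sym p q = p (Relation.Binary.PropositionalEquality.sym q)

KSym : (n : ℕ) → ∀ {x y} → KAdj n x y → KAdj n y x
KSym n {inj₁ i} {inj₂ j} p = ≢-sym p
KSym n {inj₂ i} {inj₁ j} p = ≢-sym p

KIrr : (n : ℕ) → ∀ {x} → ¬ KAdj n x x
KIrr n {inj₁ i} ()
KIrr n {inj₂ i} ()

KStar : ℕ → Graph
KStar n = record { V = Fin n ⊎ Fin n ; Adj = KAdj n ; sym = KSym n ; irrefl = KIrr n }

-- Write n = 2r + 1 and view both sides of K*ₙ as ℤₙ, with aᵢ ~ bⱼ iff i ≠ j.
-- A closed walk a(α 0) b(β 0) a(α 1) … a(α R), R = r n, traverses every edge exactly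
-- once as soon as every pair (i, d) with d ≢ 0 occurs exactly once as (a-end, b-end − a-end)
-- of one of its steps (a difference scheme).  The first circuit takes α N = N with
-- differences 2p + 2 and 2p + 1 during the p-th block of n rounds.  The second takes
-- α N = N + 2r − 3 with differences 2q + 4 and 2q + 3 on the q-th block of the middle
-- range 2 ≤ N < 2 + (r − 1) n, and α N = −N with differences 1 and 2 elsewhere.  At each
-- time the two walks sit at distinct vertices of the same side, so they are never
-- adjacent; as K*ₙ is vertex-transitive, automorphisms move this pair to every vertex.

module Submission where

open import Data.Empty using (⊥; ⊥-elim)
open import Data.Fin using (Fin; inject₁; toℕ; fromℕ<)
import Data.Fin as Fin
open import Data.Fin.Permutation using (Permutation′; _⟨$⟩ʳ_; _⟨$⟩ˡ_; inverseˡ; inverseʳ; transpose)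
open import Data.Fin.Properties using (toℕ-injective; toℕ-fromℕ<; toℕ<n; toℕ-inject₁; toℕ-fromℕ)
open import Data.Nat
open import Data.Nat.DivMod
open import Data.Nat.Divisibility using (n∣m*n)
open import Data.Nat.Properties
open import Data.Nat.Tactic.RingSolver using (solve-∀)
open import Data.Product using (Σ; ∃; _×_; _,_; proj₁; proj₂)
open import Data.Sum using (_⊎_; inj₁; inj₂)
import Data.Sum as Sum
import Data.Sum.Properties as Sum
open import Function using (_∘_)
open import Level using (0ℓ)
open import Relation.Binary.Bundles using (Setoid)
open import Relation.Binary.PropositionalEquality
import Relation.Binary.Reasoning.Setoid
open import Relation.Nullary using (¬_; Dec; yes; no)
open import Relation.Nullary.Decidable using (dec-true; _×-dec_)

open import Defs hiding (sym)

m+m≡n+n⇒m≡n : ∀ {m n} → m + m ≡ n + n → m ≡ n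
m+m≡n+n⇒m≡n {zero}  {zero}  _ = refl
m+m≡n+n⇒m≡n {suc m} {suc n} e rewrite +-suc m m | +-suc n n =
  cong suc (m+m≡n+n⇒m≡n (suc-injective (suc-injective e)))

1+m+m≢n+n : ∀ m n → suc (m + m) ≢ n + n
1+m+m≢n+n zero    (suc n) e rewrite +-suc n n with e
... | ()
1+m+m≢n+n (suc m) (suc n) e rewrite +-suc m m | +-suc n n =
  1+m+m≢n+n m n (suc-injective (suc-injective e))

m+m<n+n⇒m<n : ∀ {m n} → m + m < n + n → m < n
m+m<n+n⇒m<n {m} {n} lt with m <? n
... | yes m<n = m<n
... | no m≮n  = ⊥-elim (<⇒≱ lt (+-mono-≤ (≮⇒≥ m≮n) (≮⇒≥ m≮n)))

m+m≤n+n⇒m≤n : ∀ {m n} → m + m ≤ n + n → m ≤ n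
m+m≤n+n⇒m≤n {m} {n} le with m ≤? n
... | yes m≤n = m≤n
... | no m≰n  = ⊥-elim (<⇒≱ (+-mono-< (≰⇒> m≰n) (≰⇒> m≰n)) le)

1+m+m<n+n⇒m<n : ∀ {m n} → suc (m + m) < n + n → m < n
1+m+m<n+n⇒m<n lt = m+m<n+n⇒m<n (<-trans (n<1+n _) lt)

m<n⇒1+m+m<n+n : ∀ {m n} → m < n → suc (m + m) < n + n
m<n⇒1+m+m<n+n {m} {n} lt = subst (_≤ n + n) (cong suc (+-suc m m)) (+-mono-≤ lt lt)

data EvenOdd : ℕ → Set where
  even : ∀ m → EvenOdd (m + m)
  odd  : ∀ m → EvenOdd (suc (m + m))

evenOdd : ∀ t → EvenOdd t
evenOdd zero = even 0
evenOdd (suc t) with evenOdd t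
... | even m = odd m
... | odd m  = subst EvenOdd (cong suc (+-suc m m)) (even (suc m))

interleave : {A : Set} → (ℕ → A) → (ℕ → A) → ℕ → A
interleave a b zero          = a 0
interleave a b (suc zero)    = b 0
interleave a b (suc (suc t)) = interleave (a ∘ suc) (b ∘ suc) t

interleave-even : {A : Set} (a b : ℕ → A) (m : ℕ) → interleave a b (m + m) ≡ a m
interleave-even a b zero    = refl
interleave-even a b (suc m) rewrite +-suc m m = interleave-even (a ∘ suc) (b ∘ suc) m

interleave-odd : {A : Set} (a b : ℕ → A) (m : ℕ) → interleave a b (suc (m + m)) ≡ b m
interleave-odd a b zero    = refl
interleave-odd a b (suc m) rewrite +-suc m m = interleave-odd (a ∘ suc) (b ∘ suc) m

module Congruence (n : ℕ) .{{_ : NonZero n}} where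

  -- A record rather than  x % n ≡ y % n  so that x and y are recoverable by unification.
  infix 4 _≈_ _≉_
  record _≈_ (x y : ℕ) : Set where
    constructor mk≈
    field residue-eq : x % n ≡ y % n
  open _≈_ public

  _≉_ : ℕ → ℕ → Set
  x ≉ y = ¬ x ≈ y

  ≈-refl : ∀ {x} → x ≈ x
  ≈-refl = mk≈ refl

  ≈-sym : ∀ {x y} → x ≈ y → y ≈ x
  ≈-sym (mk≈ e) = mk≈ (sym e)

  ≈-trans : ∀ {x y z} → x ≈ y → y ≈ z → x ≈ z
  ≈-trans (mk≈ e) (mk≈ f) = mk≈ (trans e f)

  ≈-setoid : Setoid 0ℓ 0ℓ
  ≈-setoid = record
    { Carrier = ℕ ; _≈_ = _≈_
    ; isEquivalence = record { refl = ≈-refl ; sym = ≈-sym ; trans = ≈-trans } }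

  module ≈-Reasoning = Relation.Binary.Reasoning.Setoid ≈-setoid

  ≡⇒≈ : ∀ {x y} → x ≡ y → x ≈ y
  ≡⇒≈ refl = ≈-refl

  m%n≈m : ∀ x → x % n ≈ x
  m%n≈m x = mk≈ (m%n%n≡m%n x n)

  m+kn≈m : ∀ x k → x + k * n ≈ x
  m+kn≈m x k = mk≈ ([m+kn]%n≡m%n x k n)

  n≈0 : n ≈ 0
  n≈0 = mk≈ (trans (n%n≡0 n) (sym (m<n⇒m%n≡m (>-nonZero⁻¹ n))))

  ≈⇒≡ : ∀ {x y} → x < n → y < n → x ≈ y → x ≡ y
  ≈⇒≡ x<n y<n (mk≈ e) = trans (sym (m<n⇒m%n≡m x<n)) (trans e (m<n⇒m%n≡m y<n))

  +-congʳ : ∀ {x y} z → x ≈ y → x + z ≈ y + z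
  +-congʳ {x} {y} z (mk≈ e) = mk≈ (begin
    (x + z) % n            ≡⟨ %-distribˡ-+ x z n ⟩
    (x % n + z % n) % n    ≡⟨ cong (λ u → (u + z % n) % n) e ⟩
    (y % n + z % n) % n    ≡⟨ %-distribˡ-+ y z n ⟨
    (y + z) % n            ∎)
    where open ≡-Reasoning

  +-congˡ : ∀ {x y} z → x ≈ y → z + x ≈ z + y
  +-congˡ {x} {y} z e = ≈-trans (≡⇒≈ (+-comm z x)) (≈-trans (+-congʳ z e) (≡⇒≈ (+-comm y z)))

  +-cong : ∀ {x y u v} → x ≈ y → u ≈ v → x + u ≈ y + v
  +-cong {y = y} {u} e f = ≈-trans (+-congʳ u e) (+-congˡ y f)

  -- Adding  pred n  undoes a successor modulo n.
  suc-injective-≈ : ∀ {x y} → suc x ≈ suc y → x ≈ y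
  suc-injective-≈ {x} {y} e = begin
    x                ≈⟨ m+kn≈m x 1 ⟨
    x + 1 * n        ≡⟨ x+n≡1+x+[n-1] x ⟩
    suc x + pred n   ≈⟨ +-congʳ (pred n) e ⟩
    suc y + pred n   ≡⟨ x+n≡1+x+[n-1] y ⟨
    y + 1 * n        ≈⟨ m+kn≈m y 1 ⟩
    y                ∎
    where
    open ≈-Reasoning
    x+n≡1+x+[n-1] : ∀ w → w + 1 * n ≡ suc w + pred n
    x+n≡1+x+[n-1] w = trans (cong (w +_) (trans (*-identityˡ n) (sym (suc-pred n)))) (+-suc w (pred n))

  +-cancelˡ-≈ : ∀ a {x y} → a + x ≈ a + y → x ≈ y
  +-cancelˡ-≈ zero    e = e
  +-cancelˡ-≈ (suc a) e = +-cancelˡ-≈ a (suc-injective-≈ e)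

  +-cancelʳ-≈ : ∀ a {x y} → x + a ≈ y + a → x ≈ y
  +-cancelʳ-≈ a {x} {y} e = +-cancelˡ-≈ a (≈-trans (≡⇒≈ (+-comm a x)) (≈-trans e (≡⇒≈ (+-comm y a))))

  m≉m+d : ∀ x {d} → 0 < d → d < n → x ≉ x + d
  m≉m+d x {d} 0<d d<n e =
    <⇒≢ 0<d (≈⇒≡ (>-nonZero⁻¹ n) d<n (+-cancelˡ-≈ x (≈-trans (≡⇒≈ (+-identityʳ x)) e)))

  ≈⇒≡-within : ∀ {a x y} → a ≤ x → a ≤ y → x < a + n → y < a + n → x ≈ y → x ≡ y
  ≈⇒≡-within {a} {x} {y} a≤x a≤y x<a+n y<a+n e = begin
    x           ≡⟨ m∸n+n≡m a≤x ⟨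
    x ∸ a + a   ≡⟨ cong (_+ a) (≈⇒≡ (m<n+o⇒m∸n<o x a x<a+n) (m<n+o⇒m∸n<o y a y<a+n) offsets) ⟩
    y ∸ a + a   ≡⟨ m∸n+n≡m a≤y ⟩
    y           ∎
    where
    open ≡-Reasoning
    offsets : x ∸ a ≈ y ∸ a
    offsets = +-cancelʳ-≈ a (≈-trans (≡⇒≈ (m∸n+n≡m a≤x)) (≈-trans e (≡⇒≈ (sym (m∸n+n≡m a≤y)))))

  difference-exists : ∀ a x → ∃ λ k → k < n × a + k ≈ x
  difference-exists zero    x = x % n , m%n<n x n , m%n≈m x
  difference-exists (suc a) x with difference-exists a x
  ... | suc k , 1+k<n , e = k , <-trans (n<1+n k) 1+k<n , ≈-trans (≡⇒≈ (sym (+-suc a k))) e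
  ... | zero  , _     , e = pred n , pred-n<n , (begin
    suc a + pred n   ≡⟨ +-suc a (pred n) ⟨
    a + suc (pred n) ≡⟨ cong (a +_) (trans (suc-pred n) (sym (*-identityˡ n))) ⟩
    a + 1 * n        ≈⟨ m+kn≈m a 1 ⟩
    a                ≡⟨ +-identityʳ a ⟨
    a + 0            ≈⟨ e ⟩
    x                ∎)
    where
    open ≈-Reasoning
    pred-n<n : pred n < n
    pred-n<n = subst (pred n <_) (suc-pred n) (n<1+n (pred n))

  nonzero-difference : ∀ {i j} → i < n → j < n → i ≢ j → ∃ λ d → 0 < d × d < n × i + d ≈ j
  nonzero-difference {i} {j} i<n j<n i≢j with difference-exists i j
  ... | zero  , _   , i+0≈j = ⊥-elim (i≢j (≈⇒≡ i<n j<n (≈-trans (≡⇒≈ (sym (+-identityʳ i))) i+0≈j)))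
  ... | suc d , d<n , i+d≈j = suc d , s≤s z≤n , d<n , i+d≈j

  multiple≈0 : ∀ k {y} → y ≈ 0 → k * y ≈ 0
  multiple≈0 zero    _ = ≈-refl
  multiple≈0 (suc k) e = +-cong e (multiple≈0 k e)

  -- For n = 2h + 1, multiplying by h + 1 halves modulo n.
  m+m≈0⇒m≈0 : ∀ {h} → n ≡ suc (h + h) → ∀ x → x + x ≈ 0 → x ≈ 0
  m+m≈0⇒m≈0 {h} n≡1+h+h x e = begin
    x                     ≈⟨ m+kn≈m x x ⟨
    x + x * n             ≡⟨ cong (λ m → x + x * m) n≡1+h+h ⟩
    x + x * suc (h + h)   ≡⟨ identity x h ⟩
    suc h * (x + x)       ≈⟨ multiple≈0 (suc h) e ⟩
    0                     ∎
    where
    open ≈-Reasoning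
    identity : ∀ x h → x + x * suc (h + h) ≡ suc h * (x + x)
    identity = solve-∀

record Automorphism (G : Graph) : Set where
  field
    to from  : V G → V G
    from-to  : ∀ x → from (to x) ≡ x
    to-from  : ∀ x → to (from x) ≡ x
    to-adj   : ∀ {x y} → Adj G x y → Adj G (to x) (to y)
    from-adj : ∀ {x y} → Adj G x y → Adj G (from x) (from y)

  to-injective : ∀ {x y} → to x ≡ to y → x ≡ y
  to-injective {x} {y} e = trans (sym (from-to x)) (trans (cong from e) (from-to y))

  adj-to⇒adj : ∀ {x y} → Adj G (to x) (to y) → Adj G x y
  adj-to⇒adj a = subst₂ (Adj G) (from-to _) (from-to _) (from-adj a)

_∘ᴬ_ : {G : Graph} → Automorphism G → Automorphism G → Automorphism G
σ ∘ᴬ τ = record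
  { to       = σ.to ∘ τ.to
  ; from     = τ.from ∘ σ.from
  ; from-to  = λ x → trans (cong τ.from (σ.from-to (τ.to x))) (τ.from-to x)
  ; to-from  = λ x → trans (cong σ.to (τ.to-from (σ.from x))) (σ.to-from x)
  ; to-adj   = σ.to-adj ∘ τ.to-adj
  ; from-adj = τ.from-adj ∘ σ.from-adj
  }
  where module σ = Automorphism σ
        module τ = Automorphism τ

AvoidingPairAt : (G : Graph) → V G → Set
AvoidingPairAt G u =
  Σ ℕ λ ℓ → Σ (EulerianCircuit G u ℓ) λ c → Σ (EulerianCircuit G u ℓ) λ d → Avoiding c d

module _ {G : Graph} (σ : Automorphism G) where
  open Automorphism σ

  map-sameEdge : ∀ {a b c d} → SameEdge a b c d → SameEdge (to a) (to b) (to c) (to d)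
  map-sameEdge (inj₁ (p , q)) = inj₁ (cong to p , cong to q)
  map-sameEdge (inj₂ (p , q)) = inj₂ (cong to p , cong to q)

  unmap-sameEdge : ∀ {a b c d} → SameEdge (to a) (to b) (to c) (to d) → SameEdge a b c d
  unmap-sameEdge (inj₁ (p , q)) = inj₁ (to-injective p , to-injective q)
  unmap-sameEdge (inj₂ (p , q)) = inj₂ (to-injective p , to-injective q)

  map-circuit : ∀ {u ℓ} → EulerianCircuit G u ℓ → EulerianCircuit G (to u) ℓ
  map-circuit c = record
    { walk     = to ∘ walk c
    ; start    = cong to (start c)
    ; end      = cong to (end c)
    ; isEdge   = to-adj ∘ isEdge c
    ; noRepeat = λ i j e → noRepeat c i j (unmap-sameEdge e)
    ; covers   = covers′
    }
    where
    covers′ : ∀ x y → Adj G x y → ∃ λ j →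
              SameEdge (to (walk c (inject₁ j))) (to (walk c (Fin.suc j))) x y
    covers′ x y a with covers c (from x) (from y) (from-adj a)
    ... | j , e = j , subst₂ (SameEdge _ _) (to-from x) (to-from y) (map-sameEdge e)

  map-avoiding : ∀ {u ℓ} {c d : EulerianCircuit G u ℓ} → Avoiding c d →
                 Avoiding (map-circuit c) (map-circuit d)
  map-avoiding av i 1≤i i<ℓ = proj₁ (av i 1≤i i<ℓ) ∘ to-injective , proj₂ (av i 1≤i i<ℓ) ∘ adj-to⇒adj

  map-avoidingPair : ∀ {u} → AvoidingPairAt G u → AvoidingPairAt G (to u)
  map-avoidingPair (ℓ , c , d , av) = ℓ , map-circuit c , map-circuit d , map-avoiding {c = c} {d} av

transitive∧avoidingPair⇒doublyEulerian : {G : Graph} (u₀ : V G) →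
  (∀ v → Σ (Automorphism G) λ σ → Automorphism.to σ u₀ ≡ v) →
  AvoidingPairAt G u₀ → DoublyEulerian G
transitive∧avoidingPair⇒doublyEulerian {G} u₀ transitive pair@(ℓ , c , _) =
  (u₀ , ℓ , c) , λ v → let (σ , σu₀≡v) = transitive v in
                         subst (AvoidingPairAt G) σu₀≡v (map-avoidingPair σ pair)

module _ (n : ℕ) where

  relabel : Permutation′ n → Automorphism (KStar n)
  relabel π = record
    { to       = Sum.map (π ⟨$⟩ʳ_) (π ⟨$⟩ʳ_)
    ; from     = Sum.map (π ⟨$⟩ˡ_) (π ⟨$⟩ˡ_)
    ; from-to  = λ { (inj₁ i) → cong inj₁ (inverseˡ π) ; (inj₂ i) → cong inj₂ (inverseˡ π) }
    ; to-from  = λ { (inj₁ i) → cong inj₁ (inverseʳ π) ; (inj₂ i) → cong inj₂ (inverseʳ π) }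
    ; to-adj   = λ { {inj₁ _} {inj₂ _} i≢j → i≢j ∘ injectiveʳ ; {inj₂ _} {inj₁ _} i≢j → i≢j ∘ injectiveʳ }
    ; from-adj = λ { {inj₁ _} {inj₂ _} i≢j → i≢j ∘ injectiveˡ ; {inj₂ _} {inj₁ _} i≢j → i≢j ∘ injectiveˡ }
    }
    where
    injectiveʳ : ∀ {i j} → π ⟨$⟩ʳ i ≡ π ⟨$⟩ʳ j → i ≡ j
    injectiveʳ e = trans (sym (inverseˡ π)) (trans (cong (π ⟨$⟩ˡ_) e) (inverseˡ π))
    injectiveˡ : ∀ {i j} → π ⟨$⟩ˡ i ≡ π ⟨$⟩ˡ j → i ≡ j
    injectiveˡ e = trans (sym (inverseʳ π)) (trans (cong (π ⟨$⟩ʳ_) e) (inverseʳ π))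

  swap-sides : Automorphism (KStar n)
  swap-sides = record
    { to       = Sum.swap
    ; from     = Sum.swap
    ; from-to  = Sum.swap-involutive
    ; to-from  = Sum.swap-involutive
    ; to-adj   = λ { {inj₁ _} {inj₂ _} a → a ; {inj₂ _} {inj₁ _} a → a }
    ; from-adj = λ { {inj₁ _} {inj₂ _} a → a ; {inj₂ _} {inj₁ _} a → a }
    }

  transpose-maps : (i j : Fin n) → transpose i j ⟨$⟩ʳ i ≡ j
  transpose-maps i j rewrite dec-true (i Fin.≟ i) refl = refl

  KStar-transitive : (z : Fin n) (v : V (KStar n)) →
                     Σ (Automorphism (KStar n)) λ σ → Automorphism.to σ (inj₁ z) ≡ v
  KStar-transitive z (inj₁ k) = relabel (transpose z k) , cong inj₁ (transpose-maps z k)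
  KStar-transitive z (inj₂ k) = swap-sides ∘ᴬ relabel (transpose z k) , cong inj₂ (transpose-maps z k)

module Circuits (n : ℕ) .{{_ : NonZero n}} where
  open Congruence n public

  residue : ℕ → Fin n
  residue x = x mod n

  residue-injective : ∀ {x y} → residue x ≡ residue y → x ≈ y
  residue-injective {x} {y} e = mk≈ (trans (sym (toℕ-fromℕ< _)) (trans (cong toℕ e) (toℕ-fromℕ< _)))

  residue-cong : ∀ {x y} → x ≈ y → residue x ≡ residue y
  residue-cong {x} {y} e = toℕ-injective (trans (toℕ-fromℕ< _) (trans (residue-eq e) (sym (toℕ-fromℕ< _))))

  residue-toℕ : ∀ {x} (i : Fin n) → x ≈ toℕ i → residue x ≡ i
  residue-toℕ i e = trans (residue-cong e) (toℕ-injective (trans (toℕ-fromℕ< _) (m<n⇒m%n≡m (toℕ<n i))))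

  walkOf : (α β : ℕ → ℕ) → ℕ → V (KStar n)
  walkOf α β = interleave (inj₁ ∘ residue ∘ α) (inj₂ ∘ residue ∘ β)

  walkOf-even : (α β : ℕ → ℕ) (N : ℕ) → walkOf α β (N + N) ≡ inj₁ (residue (α N))
  walkOf-even α β = interleave-even _ _

  walkOf-odd : (α β : ℕ → ℕ) (N : ℕ) → walkOf α β (suc (N + N)) ≡ inj₂ (residue (β N))
  walkOf-odd α β = interleave-odd _ _

  record EulerianSequence (R : ℕ) (α β : ℕ → ℕ) : Set where
    field
      start≈0            : α 0 ≈ 0
      end≈0              : α R ≈ 0
      forward-adj        : ∀ N → N < R → α N ≉ β N
      backward-adj       : ∀ N → N < R → α (suc N) ≉ β N
      forward-injective  : ∀ N M → N < R → M < R → α N ≈ α M → β N ≈ β M → N ≡ M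
      backward-injective : ∀ N M → N < R → M < R → α (suc N) ≈ α (suc M) → β N ≈ β M → N ≡ M
      forward≢backward   : ∀ N M → N < R → M < R → α N ≈ α (suc M) → β N ≈ β M → ⊥
      covers-edges       : ∀ i j → i < n → j < n → i ≢ j →
                           (∃ λ N → N < R × α N ≈ i × β N ≈ j) ⊎
                           (∃ λ N → N < R × α (suc N) ≈ i × β N ≈ j)

  module _ {R : ℕ} {α β : ℕ → ℕ} (H : EulerianSequence R α β) where
    open EulerianSequence H

    private
      w : ℕ → V (KStar n)
      w = walkOf α β

      w-even : ∀ N → w (N + N) ≡ inj₁ (residue (α N))
      w-even = walkOf-even α β

      w-odd : ∀ N → w (suc (N + N)) ≡ inj₂ (residue (β N))
      w-odd = walkOf-odd α β

      w-even′ : ∀ N → w (suc (suc (N + N))) ≡ inj₁ (residue (α (suc N)))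
      w-even′ N = subst (λ t → w t ≡ inj₁ (residue (α (suc N)))) (cong suc (+-suc N N)) (w-even (suc N))

      step-adj : ∀ t → t < R + R → KAdj n (w t) (w (suc t))
      step-adj t t< with evenOdd t
      ... | even N rewrite w-even N | w-odd N =
        forward-adj N (m+m<n+n⇒m<n t<) ∘ residue-injective
      ... | odd N rewrite w-odd N | w-even′ N =
        backward-adj N (1+m+m<n+n⇒m<n t<) ∘ residue-injective ∘ sym

      sameEdge-subst : ∀ {x y z v x′ y′ z′ v′} → x ≡ x′ → y ≡ y′ → z ≡ z′ → v ≡ v′ →
                       SameEdge {V (KStar n)} x y z v → SameEdge x′ y′ z′ v′
      sameEdge-subst refl refl refl refl e = e

      inj₁-residue : ∀ {x y} → inj₁ {B = Fin n} (residue x) ≡ inj₁ (residue y) → x ≈ y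
      inj₁-residue = residue-injective ∘ Sum.inj₁-injective

      inj₂-residue : ∀ {x y} → inj₂ {A = Fin n} (residue x) ≡ inj₂ (residue y) → x ≈ y
      inj₂-residue = residue-injective ∘ Sum.inj₂-injective

      no-repeat : ∀ t s → t < R + R → s < R + R →
                  SameEdge (w t) (w (suc t)) (w s) (w (suc s)) → t ≡ s
      no-repeat t s t< s< e with evenOdd t | evenOdd s
      ... | even N | even M
          with sameEdge-subst (w-even N) (w-odd N) (w-even M) (w-odd M) e
      ...   | inj₁ (a , b) = cong (λ K → K + K) (forward-injective N M
                               (m+m<n+n⇒m<n t<) (m+m<n+n⇒m<n s<) (inj₁-residue a) (inj₂-residue b))
      no-repeat t s t< s< e | odd N | odd M
          with sameEdge-subst (w-odd N) (w-even′ N) (w-odd M) (w-even′ M) e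
      ...   | inj₁ (b , a) = cong (λ K → suc (K + K)) (backward-injective N M
                               (1+m+m<n+n⇒m<n t<) (1+m+m<n+n⇒m<n s<) (inj₁-residue a) (inj₂-residue b))
      no-repeat t s t< s< e | even N | odd M
          with sameEdge-subst (w-even N) (w-odd N) (w-odd M) (w-even′ M) e
      ...   | inj₂ (a , b) = ⊥-elim (forward≢backward N M
                               (m+m<n+n⇒m<n t<) (1+m+m<n+n⇒m<n s<) (inj₁-residue a) (inj₂-residue b))
      no-repeat t s t< s< e | odd N | even M
          with sameEdge-subst (w-odd N) (w-even′ N) (w-even M) (w-odd M) e
      ...   | inj₂ (b , a) = ⊥-elim (forward≢backward M N
                               (m+m<n+n⇒m<n s<) (1+m+m<n+n⇒m<n t<)
                               (inj₁-residue (sym a)) (inj₂-residue (sym b)))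

      step-at : ∀ t → t < R + R → (P : V (KStar n) → V (KStar n) → Set) → P (w t) (w (suc t)) →
                ∃ λ (j : Fin (R + R)) → P (w (toℕ (inject₁ j))) (w (suc (toℕ j)))
      step-at t t< P p = fromℕ< t< ,
        subst₂ P (cong w (sym (trans (toℕ-inject₁ _) (toℕ-fromℕ< t<))))
                 (cong (w ∘ suc) (sym (toℕ-fromℕ< t<))) p

      covers-all : ∀ x y → KAdj n x y →
                   ∃ λ (j : Fin (R + R)) → SameEdge (w (toℕ (inject₁ j))) (w (suc (toℕ j))) x y
      covers-all (inj₁ i) (inj₂ j) i≢j
        with covers-edges (toℕ i) (toℕ j) (toℕ<n i) (toℕ<n j) (i≢j ∘ toℕ-injective)
      ... | inj₁ (N , N< , a , b) = step-at (N + N) (+-mono-< N< N<) (λ x y → SameEdge x y _ _)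
              (inj₁ (trans (w-even N) (cong inj₁ (residue-toℕ i a)) ,
                     trans (w-odd N) (cong inj₂ (residue-toℕ j b))))
      ... | inj₂ (N , N< , a , b) = step-at (suc (N + N)) (m<n⇒1+m+m<n+n N<) (λ x y → SameEdge x y _ _)
              (inj₂ (trans (w-odd N) (cong inj₂ (residue-toℕ j b)) ,
                     trans (w-even′ N) (cong inj₁ (residue-toℕ i a))))
      covers-all (inj₂ j) (inj₁ i) j≢i with covers-all (inj₁ i) (inj₂ j) (j≢i ∘ sym)
      ... | k , inj₁ (p , q) = k , inj₂ (p , q)
      ... | k , inj₂ (p , q) = k , inj₁ (p , q)

    circuit : EulerianCircuit (KStar n) (inj₁ (residue 0)) (R + R)
    circuit = record
      { walk     = w ∘ toℕ
      ; start    = cong inj₁ (residue-cong start≈0)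
      ; end      = trans (cong w (toℕ-fromℕ (R + R))) (trans (w-even R) (cong inj₁ (residue-cong end≈0)))
      ; isEdge   = λ j → subst (λ t → KAdj n (w t) (w (suc (toℕ j)))) (sym (toℕ-inject₁ j))
                             (step-adj (toℕ j) (toℕ<n j))
      ; noRepeat = λ i j e → toℕ-injective (no-repeat (toℕ i) (toℕ j) (toℕ<n i) (toℕ<n j)
                     (subst₂ (λ t s → SameEdge (w t) (w (suc (toℕ i))) (w s) (w (suc (toℕ j))))
                             (toℕ-inject₁ i) (toℕ-inject₁ j) e))
      ; covers   = covers-all
      }

  avoiding : ∀ {R α β α′ β′} (H : EulerianSequence R α β) (H′ : EulerianSequence R α′ β′) →
             (∀ N → 1 ≤ N → N < R → α N ≉ α′ N) → (∀ N → N < R → β N ≉ β′ N) →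
             Avoiding (circuit H) (circuit H′)
  avoiding {R} {α} {β} {α′} {β′} _ _ α≉α′ β≉β′ i 1≤i i< = apart (toℕ i) 1≤i i<
    where
    Apart : V (KStar n) → V (KStar n) → Set
    Apart x y = x ≢ y × ¬ KAdj n x y

    -- Both walks are on the same side at every time, so they can never be adjacent.
    apart : ∀ t → 1 ≤ t → t < R + R → Apart (walkOf α β t) (walkOf α′ β′ t)
    apart t 1≤t t< with evenOdd t
    ... | even zero = ⊥-elim (<-irrefl refl 1≤t)
    ... | even (suc N) = subst₂ Apart (sym (walkOf-even α β (suc N))) (sym (walkOf-even α′ β′ (suc N)))
            (α≉α′ (suc N) (s≤s z≤n) (m+m<n+n⇒m<n t<) ∘ residue-injective ∘ Sum.inj₁-injective , λ ())
    ... | odd N = subst₂ Apart (sym (walkOf-odd α β N)) (sym (walkOf-odd α′ β′ N))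
            (β≉β′ N (1+m+m<n+n⇒m<n t<) ∘ residue-injective ∘ Sum.inj₂-injective , λ ())

  record DifferenceScheme (R : ℕ) (α β : ℕ → ℕ) : Set where
    field
      δ⁺ δ⁻              : ℕ → ℕ
      start≈0            : α 0 ≈ 0
      end≈0              : α R ≈ 0
      0<δ⁺               : ∀ N → N < R → 0 < δ⁺ N
      δ⁺<n               : ∀ N → N < R → δ⁺ N < n
      0<δ⁻               : ∀ N → N < R → 0 < δ⁻ N
      δ⁻<n               : ∀ N → N < R → δ⁻ N < n
      β≈α+δ⁺             : ∀ N → N < R → β N ≈ α N + δ⁺ N
      β≈α′+δ⁻            : ∀ N → N < R → β N ≈ α (suc N) + δ⁻ N
      δ⁺-injective       : ∀ N M → N < R → M < R → δ⁺ N ≡ δ⁺ M → α N ≈ α M → N ≡ M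
      δ⁻-injective       : ∀ N M → N < R → M < R → δ⁻ N ≡ δ⁻ M → α (suc N) ≈ α (suc M) → N ≡ M
      δ⁺≢δ⁻              : ∀ N M → N < R → M < R → δ⁺ N ≢ δ⁻ M
      covers-differences : ∀ i d → i < n → 0 < d → d < n →
                           (∃ λ N → N < R × α N ≈ i × δ⁺ N ≡ d) ⊎
                           (∃ λ N → N < R × α (suc N) ≈ i × δ⁻ N ≡ d)

    -- An edge is determined by its endpoint on the first side and the difference of its endpoints.
    eulerianSequence : EulerianSequence R α β
    eulerianSequence = record
      { start≈0            = start≈0
      ; end≈0              = end≈0
      ; forward-adj        = λ N N< e → m≉m+d (α N) (0<δ⁺ N N<) (δ⁺<n N N<) (≈-trans e (β≈α+δ⁺ N N<))
      ; backward-adj       = λ N N< e → m≉m+d (α (suc N)) (0<δ⁻ N N<) (δ⁻<n N N<) (≈-trans e (β≈α′+δ⁻ N N<))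
      ; forward-injective  = λ N M N< M< a b → δ⁺-injective N M N< M<
                               (difference-unique a b (β≈α+δ⁺ N N<) (β≈α+δ⁺ M M<) (δ⁺<n N N<) (δ⁺<n M M<)) a
      ; backward-injective = λ N M N< M< a b → δ⁻-injective N M N< M<
                               (difference-unique a b (β≈α′+δ⁻ N N<) (β≈α′+δ⁻ M M<) (δ⁻<n N N<) (δ⁻<n M M<))
                               a
      ; forward≢backward   = λ N M N< M< a b → δ⁺≢δ⁻ N M N< M<
                               (difference-unique a b (β≈α+δ⁺ N N<) (β≈α′+δ⁻ M M<) (δ⁺<n N N<) (δ⁻<n M M<))
      ; covers-edges       = covers-edges
      }
      where
      difference-unique : ∀ {a a′ b b′ d d′} → a ≈ a′ → b ≈ b′ → b ≈ a + d → b′ ≈ a′ + d′ →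
                          d < n → d′ < n → d ≡ d′
      difference-unique {a} {d′ = d′} a≈a′ b≈b′ e e′ d<n d′<n = ≈⇒≡ d<n d′<n (+-cancelˡ-≈ a
        (≈-trans (≈-sym e) (≈-trans b≈b′ (≈-trans e′ (+-congʳ d′ (≈-sym a≈a′))))))

      covers-edges : ∀ i j → i < n → j < n → i ≢ j →
                     (∃ λ N → N < R × α N ≈ i × β N ≈ j) ⊎ (∃ λ N → N < R × α (suc N) ≈ i × β N ≈ j)
      covers-edges i j i<n j<n i≢j with nonzero-difference i<n j<n i≢j
      ... | d , 0<d , d<n , i+d≈j with covers-differences i d i<n 0<d d<n
      ... | inj₁ (N , N< , a , refl) =
            inj₁ (N , N< , a , ≈-trans (β≈α+δ⁺ N N<) (≈-trans (+-congʳ (δ⁺ N) a) i+d≈j))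
      ... | inj₂ (N , N< , a , refl) =
            inj₂ (N , N< , a , ≈-trans (β≈α′+δ⁻ N N<) (≈-trans (+-congʳ (δ⁻ N) a) i+d≈j))

module Construction (s : ℕ) where

  r : ℕ
  r = 2 + s

  n : ℕ
  n = 2 * r + 1

  open Circuits n

  R : ℕ
  R = r * n

  n≡1+r+r : n ≡ suc (r + r)
  n≡1+r+r = identity s
    where identity : ∀ s → 2 * (2 + s) + 1 ≡ suc ((2 + s) + (2 + s))
          identity = solve-∀

  below-n : ∀ {x} → x ≤ r + r → x < n
  below-n {x} x≤ = subst (x <_) (sym n≡1+r+r) (s≤s x≤)

  small<n : ∀ {x} → x ≤ 4 → x < n
  small<n x≤4 = below-n (≤-trans x≤4 (+-mono-≤ {2} {r} {2} {r} (s≤s (s≤s z≤n)) (s≤s (s≤s z≤n))))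

  1<n : 1 < n
  1<n = small<n (s≤s z≤n)

  2<n : 2 < n
  2<n = small<n (s≤s (s≤s z≤n))

  3<n : 3 < n
  3<n = small<n (s≤s (s≤s (s≤s z≤n)))

  double<n : ∀ {m} → m ≤ r → m + m < n
  double<n m≤r = below-n (+-mono-≤ m≤r m≤r)

  1+double<n : ∀ {m} → m < r → suc (m + m) < n
  1+double<n m<r = <-trans (m<n⇒1+m+m<n+n m<r) (below-n ≤-refl)

  double<n⇒ : ∀ {m} → suc m + suc m < n → m < r
  double<n⇒ {m} lt = m+m≤n+n⇒m≤n (s≤s⁻¹ (subst (suc m + suc m <_) n≡1+r+r lt))

  1+double<n⇒ : ∀ {m} → suc (m + m) < n → m < r
  1+double<n⇒ {m} lt = m+m<n+n⇒m<n (s≤s⁻¹ (subst (suc (m + m) <_) n≡1+r+r lt))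

  R≈0 : R ≈ 0
  R≈0 = mk≈ (trans (m*n%n≡0 r n) (sym (m<n⇒m%n≡m (>-nonZero⁻¹ n))))

  block : ℕ → ℕ
  block N = N / n

  block< : ∀ {N} → N < R → block N < r
  block< = m<n*o⇒m/o<n

  block-of : ∀ {k} p → k < n → block (k + p * n) ≡ p
  block-of {k} p k<n = trans (+-distrib-/-∣ʳ k (n∣m*n p)) (cong₂ _+_ (m<n⇒m/n≡0 k<n) (m*n/n≡m p n))

  ≈∧block≡⇒≡ : ∀ {N M} → N ≈ M → block N ≡ block M → N ≡ M
  ≈∧block≡⇒≡ {N} {M} e b = begin
    N                      ≡⟨ m≡m%n+[m/n]*n N n ⟩
    N % n + block N * n    ≡⟨ cong₂ (λ x p → x + p * n) (residue-eq e) b ⟩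
    M % n + block M * n    ≡⟨ m≡m%n+[m/n]*n M n ⟨
    M                      ∎
    where open ≡-Reasoning

  k+pn<R : ∀ {k p} → k < n → p < r → k + p * n < R
  k+pn<R {k} {p} k<n p<r = <-≤-trans (+-monoˡ-< (p * n) k<n) (*-monoˡ-≤ n p<r)

  α₁ β₁ δ₁⁺ δ₁⁻ : ℕ → ℕ
  α₁ N  = N
  δ₁⁺ N = suc (block N) + suc (block N)
  δ₁⁻ N = suc (block N + block N)
  β₁ N  = N + δ₁⁺ N

  first : DifferenceScheme R α₁ β₁
  first = record
    { δ⁺                 = δ₁⁺
    ; δ⁻                 = δ₁⁻
    ; start≈0            = ≈-refl
    ; end≈0              = R≈0
    ; 0<δ⁺               = λ _ _ → s≤s z≤n
    ; δ⁺<n               = λ _ N< → double<n (block< N<)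
    ; 0<δ⁻               = λ _ _ → s≤s z≤n
    ; δ⁻<n               = λ _ N< → 1+double<n (block< N<)
    ; β≈α+δ⁺             = λ _ _ → ≈-refl
    ; β≈α′+δ⁻            = λ N _ → ≡⇒≈ (trans (+-suc N (block N + suc (block N)))
                                           (cong (suc ∘ (N +_)) (+-suc (block N) (block N))))
    ; δ⁺-injective       = λ _ _ _ _ e a → ≈∧block≡⇒≡ a (suc-injective (m+m≡n+n⇒m≡n e))
    ; δ⁻-injective       = λ _ _ _ _ e a → ≈∧block≡⇒≡ (suc-injective-≈ a) (m+m≡n+n⇒m≡n (suc-injective e))
    ; δ⁺≢δ⁻              = λ N M _ _ e → 1+m+m≢n+n (block M) (suc (block N)) (sym e)
    ; covers-differences = all-differences₁
    }
    where
    all-differences₁ : ∀ i d → i < n → 0 < d → d < n →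
                       (∃ λ N → N < R × α₁ N ≈ i × δ₁⁺ N ≡ d) ⊎
                       (∃ λ N → N < R × α₁ (suc N) ≈ i × δ₁⁻ N ≡ d)
    all-differences₁ i d i<n 0<d d<n with evenOdd d
    ... | even zero    = ⊥-elim (<-irrefl refl 0<d)
    ... | even (suc p) = inj₁ (i + p * n , k+pn<R i<n (double<n⇒ {p} d<n) , m+kn≈m i p ,
                               cong (λ b → suc b + suc b) (block-of p i<n))
    ... | odd p with difference-exists 1 i
    ...   | i′ , i′<n , 1+i′≈i = inj₂ (i′ + p * n , k+pn<R i′<n (1+double<n⇒ {p} d<n) ,
                                       ≈-trans (m+kn≈m (suc i′) p) 1+i′≈i ,
                                       cong (λ b → suc (b + b)) (block-of {i′} p i′<n))

  shift : ℕ
  shift = suc (s + s)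

  shift+4≡n : shift + 4 ≡ n
  shift+4≡n = identity s
    where identity : ∀ s → suc (s + s) + 4 ≡ 2 * (2 + s) + 1
          identity = solve-∀

  shift<n : shift < n
  shift<n = subst (shift <_) shift+4≡n (m<m+n shift (s≤s z≤n))

  P : ℕ
  P = 2 + suc s * n

  P≤R : P ≤ R
  P≤R = +-monoˡ-≤ (suc s * n) (<⇒≤ 2<n)

  P+n≡R+2 : P + n ≡ R + 2
  P+n≡R+2 = identity (suc s) n
    where identity : ∀ a b → (2 + a * b) + b ≡ (b + a * b) + 2
          identity = solve-∀

  R∸N+N≈0 : ∀ {N} → N ≤ R → R ∸ N + N ≈ 0
  R∸N+N≈0 N≤R = ≈-trans (≡⇒≈ (m∸n+n≡m N≤R)) R≈0

  R∸-injective-≈ : ∀ {N M} → N ≤ R → M ≤ R → R ∸ N ≈ R ∸ M → N ≈ M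
  R∸-injective-≈ {N} {M} N≤R M≤R e =
    +-cancelˡ-≈ (R ∸ M) (≈-trans (+-congʳ N (≈-sym e)) (≈-trans (R∸N+N≈0 N≤R) (≈-sym (R∸N+N≈0 M≤R))))

  R∸N≈i : ∀ {N i} → N ≤ R → i ≤ n → N ≈ n ∸ i → R ∸ N ≈ i
  R∸N≈i {N} {i} N≤R i≤n e = +-cancelʳ-≈ N (≈-trans (R∸N+N≈0 N≤R) (≈-sym (begin
    i + N         ≈⟨ +-congˡ i e ⟩
    i + (n ∸ i)   ≡⟨ m+[n∸m]≡n i≤n ⟩
    n             ≈⟨ n≈0 ⟩
    0             ∎)))
    where open ≈-Reasoning

  -- Boundary values at which the two formulas for the second circuit must agree.
  2+shift≈R∸2 : 2 + shift ≈ R ∸ 2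
  2+shift≈R∸2 = +-cancelʳ-≈ 2 (begin
    2 + shift + 2   ≡⟨ cong (_+ 2) (+-comm 2 shift) ⟩
    shift + 2 + 2   ≡⟨ trans (+-assoc shift 2 2) shift+4≡n ⟩
    n               ≈⟨ n≈0 ⟩
    0               ≈⟨ R∸N+N≈0 (≤-trans (s≤s (s≤s z≤n)) P≤R) ⟨
    R ∸ 2 + 2       ∎)
    where open ≈-Reasoning

  R∸P≈P+shift : R ∸ P ≈ P + shift
  R∸P≈P+shift = +-cancelʳ-≈ P (≈-trans (R∸N+N≈0 P≤R) (≈-sym (begin
    P + shift + P                 ≡⟨ identity shift (suc s) n ⟩
    (shift + 4) + (suc s + suc s) * n  ≈⟨ m+kn≈m (shift + 4) (suc s + suc s) ⟩
    shift + 4                     ≡⟨ shift+4≡n ⟩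
    n                             ≈⟨ n≈0 ⟩
    0                             ∎)))
    where
    open ≈-Reasoning
    identity : ∀ c a b → ((2 + a * b) + c) + (2 + a * b) ≡ (c + 4) + (a + a) * b
    identity = solve-∀

  Inside Outside : ℕ → Set
  Inside  N = 2 ≤ N × N < P
  Outside N = N < 2 ⊎ P ≤ N

  inside? : ∀ N → Dec (Inside N)
  inside? N = 2 ≤? N ×-dec N <? P

  ¬inside⇒outside : ∀ {N} → ¬ Inside N → Outside N
  ¬inside⇒outside {N} ¬in with 2 ≤? N
  ... | no 2≰N  = inj₁ (≰⇒> 2≰N)
  ... | yes 2≤N = inj₂ (≮⇒≥ (λ N<P → ¬in (2≤N , N<P)))

  outside⇒¬inside : ∀ {N} → Outside N → ¬ Inside N
  outside⇒¬inside (inj₁ N<2) (2≤N , _)   = <⇒≱ N<2 2≤N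
  outside⇒¬inside (inj₂ P≤N) (_   , N<P) = <⇒≱ N<P P≤N

  -- Lifting the points below 2 by R, the outside points fill the window [P, P + n) of length n.
  outside-≈⇒≡ : ∀ {N M} → Outside N → Outside M → N < R → M < R → N ≈ M → N ≡ M
  outside-≈⇒≡ (inj₁ N<2) (inj₁ M<2) _ _ e = ≈⇒≡ (<-trans N<2 2<n) (<-trans M<2 2<n) e
  outside-≈⇒≡ (inj₂ P≤N) (inj₂ P≤M) N<R M<R e = ≈⇒≡-within P≤N P≤M (below-window N<R) (below-window M<R) e
    where below-window : ∀ {X} → X < R → X < P + n
          below-window {X} X<R = subst (X <_) (sym P+n≡R+2) (≤-trans X<R (m≤m+n R 2))
  outside-≈⇒≡ {N} {M} (inj₁ N<2) (inj₂ P≤M) N<R M<R e = ⊥-elim (<⇒≱ M<R (begin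
    R       ≤⟨ m≤n+m R N ⟩
    N + R   ≡⟨ ≈⇒≡-within (≤-trans P≤R (m≤n+m R N)) P≤M N+R<P+n M<P+n (≈-trans (m+kn≈m N r) e) ⟩
    M       ∎))
    where
    open ≤-Reasoning
    N+R<P+n : N + R < P + n
    N+R<P+n = subst (N + R <_) (sym P+n≡R+2) (subst (_≤ R + 2) (+-comm R (suc N)) (+-monoʳ-≤ R N<2))
    M<P+n : M < P + n
    M<P+n = subst (M <_) (sym P+n≡R+2) (≤-trans M<R (m≤m+n R 2))
  outside-≈⇒≡ (inj₂ P≤N) (inj₁ M<2) N<R M<R e = sym (outside-≈⇒≡ (inj₁ M<2) (inj₂ P≤N) M<R N<R (≈-sym e))

  outside-solve : ∀ x → ∃ λ N → N < R × Outside N × N ≈ x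
  outside-solve x with x % n <? 2
  ... | yes x%n<2 = x % n , <-≤-trans (m%n<n x n) (m≤m+n n (suc s * n)) , inj₁ x%n<2 , m%n≈m x
  ... | no  x%n≮2 = x % n + suc s * n , +-monoˡ-< (suc s * n) (m%n<n x n) ,
                    inj₂ (+-monoˡ-≤ (suc s * n) (≮⇒≥ x%n≮2)) , ≈-trans (m+kn≈m (x % n) (suc s)) (m%n≈m x)

  inner-block : ℕ → ℕ
  inner-block N = block (N ∸ 2)

  inner-block< : ∀ {N} → Inside N → inner-block N < suc s
  inner-block< {N} (2≤N , N<P) =
    m<n*o⇒m/o<n (+-cancelˡ-< 2 (N ∸ 2) (suc s * n) (subst (_< P) (sym (m+[n∸m]≡n 2≤N)) N<P))

  inside-≈⇒≡ : ∀ {N M} → Inside N → Inside M → inner-block N ≡ inner-block M → N ≈ M → N ≡ M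
  inside-≈⇒≡ {N} {M} (2≤N , _) (2≤M , _) b e = ∸-cancelʳ-≡ 2≤N 2≤M (≈∧block≡⇒≡ offsets b)
    where offsets : N ∸ 2 ≈ M ∸ 2
          offsets = +-cancelʳ-≈ 2 (≈-trans (≡⇒≈ (m∸n+n≡m 2≤N)) (≈-trans e (≡⇒≈ (sym (m∸n+n≡m 2≤M)))))

  inside-solve : ∀ x p → p < suc s → ∃ λ N → N < R × Inside N × inner-block N ≡ p × N ≈ x
  inside-solve x p p<r-1 with difference-exists 2 x
  ... | k , k<n , 2+k≈x = 2 + (k + p * n) , ≤-trans N<P P≤R , (s≤s (s≤s z≤n) , N<P) , block-of p k<n ,
                          ≈-trans (+-congˡ 2 (m+kn≈m k p)) 2+k≈x
    where N<P : 2 + (k + p * n) < P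
          N<P = +-monoʳ-< 2 (<-≤-trans (+-monoˡ-< (p * n) k<n) (*-monoˡ-≤ n p<r-1))

  byRegion : ℕ → ℕ → ℕ → ℕ
  byRegion N x y with inside? N
  ... | yes _ = x
  ... | no  _ = y

  byRegion-inside : ∀ {N x y} → Inside N → byRegion N x y ≡ x
  byRegion-inside {N} in′ with inside? N
  ... | yes _  = refl
  ... | no ¬in = ⊥-elim (¬in in′)

  byRegion-outside : ∀ {N x y} → Outside N → byRegion N x y ≡ y
  byRegion-outside {N} out with inside? N
  ... | yes in′ = ⊥-elim (outside⇒¬inside out in′)
  ... | no  _   = refl

  α₂ β₂ δ₂⁺ δ₂⁻ : ℕ → ℕ
  α₂  N = byRegion N (N + shift) (R ∸ N)
  β₂  N = byRegion N (N + (inner-block N + inner-block N)) (suc (R ∸ N))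
  δ₂⁺ N = byRegion N ((2 + inner-block N) + (2 + inner-block N)) 1
  δ₂⁻ N = byRegion N (suc (suc (inner-block N) + suc (inner-block N))) 2

  α₂-suc-inside : ∀ {N} → Inside N → α₂ (suc N) ≈ suc N + shift
  α₂-suc-inside {N} (2≤N , N<P) with inside? (suc N)
  ... | yes _ = ≈-refl
  ... | no ¬in′ with ¬inside⇒outside ¬in′
  ...   | inj₁ 1+N<2 = ⊥-elim (<⇒≱ 1+N<2 (≤-trans 2≤N (n≤1+n N)))
  ...   | inj₂ P≤1+N with ≤-antisym P≤1+N N<P
  ...     | refl = R∸P≈P+shift

  α₂-suc-outside : ∀ {N} → Outside N → α₂ (suc N) ≈ R ∸ suc N
  α₂-suc-outside {N} out with inside? (suc N)
  ... | no _ = ≈-refl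
  ... | yes (2≤1+N , 1+N<P) with out
  ...   | inj₂ P≤N = ⊥-elim (<⇒≱ 1+N<P (≤-trans P≤N (n≤1+n N)))
  ...   | inj₁ (s≤s z≤n)       = ⊥-elim (<⇒≱ (s≤s (s≤s z≤n)) 2≤1+N)
  ...   | inj₁ (s≤s (s≤s z≤n)) = 2+shift≈R∸2

  δ₂⁺<n : ∀ N → δ₂⁺ N < n
  δ₂⁺<n N with inside? N
  ... | yes in′ = double<n (+-monoʳ-≤ 2 (s≤s⁻¹ (inner-block< in′)))
  ... | no  _   = 1<n

  δ₂⁻<n : ∀ N → δ₂⁻ N < n
  δ₂⁻<n N with inside? N
  ... | yes in′ = 1+double<n (s≤s (inner-block< in′))
  ... | no  _   = 2<n

  0<δ₂⁺ : ∀ N → 0 < δ₂⁺ N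
  0<δ₂⁺ N with inside? N
  ... | yes _ = s≤s z≤n
  ... | no  _ = s≤s z≤n

  0<δ₂⁻ : ∀ N → 0 < δ₂⁻ N
  0<δ₂⁻ N with inside? N
  ... | yes _ = s≤s z≤n
  ... | no  _ = s≤s z≤n

  β₂≈α₂+δ₂⁺ : ∀ N → β₂ N ≈ α₂ N + δ₂⁺ N
  β₂≈α₂+δ₂⁺ N with inside? N
  ... | yes _ = ≈-sym (≈-trans (≡⇒≈ (identity s N (inner-block N))) (m+kn≈m _ 1))
    where identity : ∀ s N q → (N + suc (s + s)) + ((2 + q) + (2 + q)) ≡
                               (N + (q + q)) + 1 * (2 * (2 + s) + 1)
          identity = solve-∀
  ... | no  _ = ≡⇒≈ (+-comm 1 (R ∸ N))

  β₂≈α₂′+δ₂⁻ : ∀ N → N < R → β₂ N ≈ α₂ (suc N) + δ₂⁻ N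
  β₂≈α₂′+δ₂⁻ N N<R with inside? N
  ... | yes in′ = ≈-sym (≈-trans (+-congʳ _ (α₂-suc-inside in′))
                    (≈-trans (≡⇒≈ (identity s N (inner-block N))) (m+kn≈m _ 1)))
    where identity : ∀ s N q → (suc N + suc (s + s)) + suc (suc q + suc q) ≡
                               (N + (q + q)) + 1 * (2 * (2 + s) + 1)
          identity = solve-∀
  ... | no ¬in = ≈-sym (≈-trans (+-congʳ 2 (α₂-suc-outside (¬inside⇒outside ¬in)))
                   (≡⇒≈ (trans (+-comm _ 2) (cong suc (sym (+-∸-assoc 1 N<R))))))

  δ₂⁺-injective : ∀ N M → N < R → M < R → δ₂⁺ N ≡ δ₂⁺ M → α₂ N ≈ α₂ M → N ≡ M
  δ₂⁺-injective N M N<R M<R e a with inside? N | inside? M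
  ... | yes in₁ | yes in₂ = inside-≈⇒≡ in₁ in₂ (suc-injective (suc-injective (m+m≡n+n⇒m≡n e)))
                              (+-cancelʳ-≈ shift a)
  ... | no ¬in₁ | no ¬in₂ = outside-≈⇒≡ (¬inside⇒outside ¬in₁) (¬inside⇒outside ¬in₂) N<R M<R
                              (R∸-injective-≈ (<⇒≤ N<R) (<⇒≤ M<R) a)
  ... | yes _   | no _    = ⊥-elim (1+m+m≢n+n 0 (2 + inner-block N) (sym e))
  ... | no _    | yes _   = ⊥-elim (1+m+m≢n+n 0 (2 + inner-block M) e)

  δ₂⁻-injective : ∀ N M → N < R → M < R → δ₂⁻ N ≡ δ₂⁻ M → α₂ (suc N) ≈ α₂ (suc M) → N ≡ M
  δ₂⁻-injective N M N<R M<R e a with inside? N | inside? M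
  ... | yes in₁ | yes in₂ = inside-≈⇒≡ in₁ in₂ (suc-injective (m+m≡n+n⇒m≡n (suc-injective e)))
                              (suc-injective-≈ (+-cancelʳ-≈ shift
                                (≈-trans (≈-sym (α₂-suc-inside in₁)) (≈-trans a (α₂-suc-inside in₂)))))
  ... | no ¬in₁ | no ¬in₂ = outside-≈⇒≡ out₁ out₂ N<R M<R (suc-injective-≈ (R∸-injective-≈ N<R M<R
                              (≈-trans (≈-sym (α₂-suc-outside out₁)) (≈-trans a (α₂-suc-outside out₂)))))
    where out₁ = ¬inside⇒outside ¬in₁
          out₂ = ¬inside⇒outside ¬in₂
  ... | yes _   | no _    = ⊥-elim (1+m+m≢n+n 0 (suc (inner-block N)) (sym (suc-injective e)))
  ... | no _    | yes _   = ⊥-elim (1+m+m≢n+n 0 (suc (inner-block M)) (suc-injective e))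

  δ₂⁺≢δ₂⁻ : ∀ N M → δ₂⁺ N ≢ δ₂⁻ M
  δ₂⁺≢δ₂⁻ N M e with inside? N | inside? M
  ... | yes _ | yes _ = 1+m+m≢n+n (suc (inner-block M)) (2 + inner-block N) (sym e)
  ... | yes _ | no  _ with m+m≡n+n⇒m≡n {2 + inner-block N} {1} e
  ...   | ()
  δ₂⁺≢δ₂⁻ N M e | no _ | yes _ = 0≢1+n (suc-injective e)
  δ₂⁺≢δ₂⁻ N M () | no _ | no _

  x+4+shift≈x : ∀ x → x + 4 + shift ≈ x
  x+4+shift≈x x = begin
    x + 4 + shift     ≡⟨ trans (+-assoc x 4 shift) (cong (x +_) (+-comm 4 shift)) ⟩
    x + (shift + 4)   ≡⟨ cong (x +_) (trans shift+4≡n (sym (*-identityˡ n))) ⟩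
    x + 1 * n         ≈⟨ m+kn≈m x 1 ⟩
    x                 ∎
    where open ≈-Reasoning

  all-differences₂ : ∀ i d → i < n → 0 < d → d < n →
                     (∃ λ N → N < R × α₂ N ≈ i × δ₂⁺ N ≡ d) ⊎ (∃ λ N → N < R × α₂ (suc N) ≈ i × δ₂⁻ N ≡ d)
  all-differences₂ i d i<n 0<d d<n with evenOdd d
  ... | even zero = ⊥-elim (<-irrefl refl 0<d)
  ... | odd zero with outside-solve (n ∸ i)
  ...   | N , N<R , out , N≈n-i =
          inj₁ (N , N<R , ≈-trans (≡⇒≈ (byRegion-outside out)) (R∸N≈i (<⇒≤ N<R) (<⇒≤ i<n) N≈n-i) ,
                byRegion-outside out)
  all-differences₂ i d i<n 0<d d<n | even (suc zero) with difference-exists 1 (n ∸ i)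
  ... | y , _ , 1+y≈n-i with outside-solve y
  ...   | N , N<R , out , N≈y =
          inj₂ (N , N<R ,
                ≈-trans (α₂-suc-outside out) (R∸N≈i N<R (<⇒≤ i<n) (≈-trans (+-congˡ 1 N≈y) 1+y≈n-i)) ,
                byRegion-outside out)
  all-differences₂ i d i<n 0<d d<n | even (suc (suc p))
    with inside-solve (i + 4) p (s≤s⁻¹ (double<n⇒ {suc p} d<n))
  ... | N , N<R , in′ , N-block , N≈i+4 =
          inj₁ (N , N<R ,
                ≈-trans (≡⇒≈ (byRegion-inside in′)) (≈-trans (+-congʳ shift N≈i+4) (x+4+shift≈x i)) ,
                trans (byRegion-inside in′) (cong (λ q → (2 + q) + (2 + q)) N-block))
  all-differences₂ i d i<n 0<d d<n | odd (suc p)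
    with inside-solve (i + 3) p (s≤s⁻¹ (1+double<n⇒ {suc p} d<n))
  ... | N , N<R , in′ , N-block , N≈i+3 =
          inj₂ (N , N<R , ≈-trans (α₂-suc-inside in′) (≈-trans (+-congʳ shift (+-congˡ 1 N≈i+3))
                                  (≈-trans (≡⇒≈ (cong (_+ shift) (sym (+-suc i 3)))) (x+4+shift≈x i))) ,
                trans (byRegion-inside in′) (cong (λ q → suc (suc q + suc q)) N-block))

  second : DifferenceScheme R α₂ β₂
  second = record
    { δ⁺                 = δ₂⁺
    ; δ⁻                 = δ₂⁻
    ; start≈0            = R≈0
    ; end≈0              = ≡⇒≈ (trans (byRegion-outside (inj₂ P≤R)) (n∸n≡0 R))
    ; 0<δ⁺               = λ N _ → 0<δ₂⁺ N
    ; δ⁺<n               = λ N _ → δ₂⁺<n N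
    ; 0<δ⁻               = λ N _ → 0<δ₂⁻ N
    ; δ⁻<n               = λ N _ → δ₂⁻<n N
    ; β≈α+δ⁺             = λ N _ → β₂≈α₂+δ₂⁺ N
    ; β≈α′+δ⁻            = β₂≈α₂′+δ₂⁻
    ; δ⁺-injective       = δ₂⁺-injective
    ; δ⁻-injective       = δ₂⁻-injective
    ; δ⁺≢δ⁻              = λ N M _ _ → δ₂⁺≢δ₂⁻ N M
    ; covers-differences = all-differences₂
    }

  α₁≉α₂ : ∀ N → 1 ≤ N → N < R → α₁ N ≉ α₂ N
  α₁≉α₂ N 1≤N N<R e with inside? N
  ... | yes _  = m≉m+d N (s≤s z≤n) shift<n e
  ... | no ¬in =
    <⇒≢ 1≤N (sym (outside-≈⇒≡ (¬inside⇒outside ¬in) (inj₁ (s≤s z≤n)) N<R (≤-<-trans z≤n N<R) N≈0))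
    where N≈0 : N ≈ 0
          N≈0 = m+m≈0⇒m≈0 {r} n≡1+r+r N (≈-trans (+-congʳ N e) (R∸N+N≈0 (<⇒≤ N<R)))

  block-high : ∀ {N} → P ≤ N → N < R → block N ≡ suc s
  block-high {N} P≤N N<R = ≤-antisym (s≤s⁻¹ (block< N<R))
    (≤-trans (≤-reflexive (sym (m*n/n≡m (suc s) n))) (/-monoˡ-≤ n (≤-trans (m≤n+m (suc s * n) 2) P≤N)))

  β₁≉β₂-inside : ∀ {N} → Inside N → N < R → β₁ N ≉ N + (inner-block N + inner-block N)
  β₁≉β₂-inside {N} _ N<R e = <-irrefl refl (begin-strict
    inner-block N + inner-block N   ≤⟨ +-mono-≤ q≤b q≤b ⟩
    block N + block N               <⟨ +-mono-< (n<1+n (block N)) (n<1+n (block N)) ⟩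
    suc (block N) + suc (block N)   ≡⟨ same-difference ⟨
    inner-block N + inner-block N   ∎)
    where
    open ≤-Reasoning
    q≤b : inner-block N ≤ block N
    q≤b = /-monoˡ-≤ n (m∸n≤m N 2)
    same-difference : inner-block N + inner-block N ≡ suc (block N) + suc (block N)
    same-difference = ≈⇒≡ (double<n (≤-trans q≤b (<⇒≤ (block< N<R)))) (double<n (block< N<R))
                          (≈-sym (+-cancelˡ-≈ N e))

  β₁≉β₂-high : ∀ {N} → P ≤ N → N < R → β₁ N ≉ suc (R ∸ N)
  β₁≉β₂-high {N} P≤N N<R e = N+N≉2 N P≤N N<R (begin
    N + N                  ≈⟨ m+kn≈m (N + N) 1 ⟨
    N + N + 1 * n          ≡⟨ identity s N ⟩
    N + (r + r) + suc N    ≡⟨ cong (λ b → N + (suc b + suc b) + suc N) (block-high P≤N N<R) ⟨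
    β₁ N + suc N           ≈⟨ +-congʳ (suc N) e ⟩
    suc (R ∸ N) + suc N    ≡⟨ cong suc (trans (+-suc (R ∸ N) N) (cong suc (m∸n+n≡m (<⇒≤ N<R)))) ⟩
    2 + R                  ≈⟨ +-congˡ 2 R≈0 ⟩
    2                      ∎)
    where
    open ≈-Reasoning
    identity : ∀ s N → N + N + 1 * (2 * (2 + s) + 1) ≡ N + ((2 + s) + (2 + s)) + suc N
    identity = solve-∀
    -- 2N ≈ 2 forces N ≈ 1, and 1 is itself an outside point.
    N+N≉2 : ∀ N → P ≤ N → N < R → N + N ≉ 2
    N+N≉2 zero    P≤0 _   _     = <⇒≱ (s≤s z≤n) P≤0
    N+N≉2 (suc M) P≤N N<R 2N≈2 = <⇒≱ (s≤s (s≤s z≤n)) (subst (P ≤_) N≡1 P≤N)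
      where
      M≈0 : M ≈ 0
      M≈0 = m+m≈0⇒m≈0 {r} n≡1+r+r M (+-cancelˡ-≈ 2 (≈-trans (≡⇒≈ (cong suc (sym (+-suc M M)))) 2N≈2))
      N≡1 : suc M ≡ 1
      N≡1 = outside-≈⇒≡ (inj₂ P≤N) (inj₁ (s≤s (s≤s z≤n))) N<R (≤-<-trans (s≤s z≤n) N<R) (+-congˡ 1 M≈0)

  β₁≉β₂ : ∀ N → N < R → β₁ N ≉ β₂ N
  β₁≉β₂ N N<R with inside? N
  ... | yes in′ = β₁≉β₂-inside in′ N<R
  ... | no ¬in with ¬inside⇒outside ¬in
  ...   | inj₂ P≤N             = β₁≉β₂-high P≤N N<R
  ...   | inj₁ (s≤s z≤n)       = λ e → 2≢1 (≈⇒≡ 2<n 1<n (≈-trans e (+-congˡ 1 R≈0)))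
    where 2≢1 : 2 ≢ 1
          2≢1 ()
  ...   | inj₁ (s≤s (s≤s z≤n)) = λ e → 3≢0 (≈⇒≡ 3<n (>-nonZero⁻¹ n) (begin
          3           ≈⟨ +-congʳ 1 (suc-injective-≈ (subst (λ b → suc (suc b + suc b) ≈ suc (R ∸ 1))
                                                            (block-of 0 1<n) e)) ⟩
          R ∸ 1 + 1   ≡⟨ m∸n+n≡m (≤-<-trans z≤n N<R) ⟩
          R           ≈⟨ R≈0 ⟩
          0           ∎))
    where
    open ≈-Reasoning
    3≢0 : 3 ≢ 0
    3≢0 ()

  avoidingPair : AvoidingPairAt (KStar n) (inj₁ (residue 0))
  avoidingPair = R + R , circuit H₁ , circuit H₂ , avoiding H₁ H₂ α₁≉α₂ β₁≉β₂
    where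
    H₁ = DifferenceScheme.eulerianSequence first
    H₂ = DifferenceScheme.eulerianSequence second

theorem6 : (r : ℕ) → 2 ≤ r → DoublyEulerian (KStar (2 * r + 1))
theorem6 (suc (suc s)) (s≤s (s≤s z≤n)) =
  transitive∧avoidingPair⇒doublyEulerian _ (KStar-transitive _ _) avoidingPair
  where open Construction s
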